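{- Let $n\ge 4$ and fix a $2$-coloring of the edges of the complete graph on $\{\pm1\}^n$. Consider all right angles formed by edges of length $2$, i.e. all pairs of edges $\{v, v\oplus i\oplus j\}$, $\{v, v\oplus k\oplus l\}$ with $v\in\{\pm1\}^n$ and $i,j,k,l$ distinct coordinates. Then at least a $\frac12 - \frac{1}{2\lfloor n/2\rfloor - 2}$ fraction of these right angles are monochromatic (both edges have the same color).
   Context: For $v\in\{\pm1\}^n$ and $1\le i\le n$, $v\oplus i$ denotes $v$ with its $i$-th coordinate negated. Length of an edge is Hamming distance between its endpoints. -}

module Defs where

open import Data.Bool using (Bool; true; false; not)
open import Data.Nat using (ℕ; zero; suc)
open import Data.Fin using (Fin)
open import Data.Fin.Properties using () renaming (_≟_ to _≟ᶠ_)
open import Data.Bool.Properties using () renaming (_≟_ to _≟ᵇ_)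
open import Data.Vec using (Vec; []; _∷_; updateAt)
open import Data.List using (List; []; _∷_; map; concatMap; allFin; filter; length; _++_)
open import Data.Product using (_×_; _,_)
open import Relation.Binary.PropositionalEquality using (_≡_)
open import Relation.Nullary using (Dec; ¬_; _×-dec_; ¬?)

-- The discrete cube {±1}^n, with +1 ↦ true, -1 ↦ false.
Cube : ℕ → Set
Cube n = Vec Bool n

_⊕_ : ∀ {n} → Cube n → Fin n → Cube n
v ⊕ i = updateAt v i not

allCube : (n : ℕ) → List (Cube n)
allCube zero = [] ∷ []
allCube (suc n) = map (true ∷_) (allCube n) ++ map (false ∷_) (allCube n)

-- A 2-colouring of the edges of the complete graph on the cube:
-- a colour for each unordered pair, i.e. a symmetric function.
record Coloring (n : ℕ) : Set where
  field
    colour : Cube n → Cube n → Bool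
    symm   : ∀ u w → colour u w ≡ colour w u
open Coloring public

-- Configurations (v, i, j, k, l).  Each right angle
-- {v, v⊕i⊕j}, {v, v⊕k⊕l} (i,j,k,l distinct) corresponds to exactly
-- 8 such ordered tuples, so ratios are unaffected by counting tuples.
Config : ℕ → Set
Config n = Cube n × Fin n × Fin n × Fin n × Fin n

allConfigs : (n : ℕ) → List (Config n)
allConfigs n =
  concatMap (λ v → concatMap (λ i → concatMap (λ j → concatMap (λ k →
    map (λ l → (v , i , j , k , l)) (allFin n)) (allFin n)) (allFin n)) (allFin n))
    (allCube n)

Distinct4 : ∀ {n} → Config n → Set
Distinct4 (v , i , j , k , l) =
  ¬ i ≡ j × ¬ i ≡ k × ¬ i ≡ l × ¬ j ≡ k × ¬ j ≡ l × ¬ k ≡ l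

distinct4? : ∀ {n} (x : Config n) → Dec (Distinct4 x)
distinct4? (v , i , j , k , l) =
  ¬? (i ≟ᶠ j) ×-dec ¬? (i ≟ᶠ k) ×-dec ¬? (i ≟ᶠ l) ×-dec
  ¬? (j ≟ᶠ k) ×-dec ¬? (j ≟ᶠ l) ×-dec ¬? (k ≟ᶠ l)

rightAngles : (n : ℕ) → List (Config n)
rightAngles n = filter distinct4? (allConfigs n)

Mono : ∀ {n} → Coloring n → Config n → Set
Mono c (v , i , j , k , l) = colour c v ((v ⊕ i) ⊕ j) ≡ colour c v ((v ⊕ k) ⊕ l)

mono? : ∀ {n} (c : Coloring n) (x : Config n) → Dec (Mono c x)
mono? c (v , i , j , k , l) = colour c v ((v ⊕ i) ⊕ j) ≟ᵇ colour c v ((v ⊕ k) ⊕ l)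

monoAngles : ∀ {n} → Coloring n → List (Config n)
monoAngles {n} c = filter (mono? c) (rightAngles n)

-- Fix a vertex v and colour each pair {i, j} of coordinates by the colour of the edge {v, v ⊕ i ⊕ j}, with
-- signs g_ij = ±1. Summed over ordered distinct (i, j, k, l), g_ij g_kl equals 2M_v - T_v, where T_v and M_v count
-- all and monochromatic right angles at v, and it expands to s² - 4Y + 2n(n-1) in terms of the signed degrees
-- d_i = Σ_j g_ij, s = Σ d_i, Y = Σ d_i². Cauchy–Schwarz on d_i - d_j = Σ_{k ∉ {i,j}} (g_ik - g_jk) bounds the
-- spread of the degrees, 2nY - 2s² ≤ (n-2)(2n(n-1)² - 2Y), which forces 2M_v - T_v ≥ -2T_v/(n-2) with
-- T_v = n(n-1)(n-2)(n-3). Summing over v gives M/T ≥ 1/2 - 1/(n-2) ≥ 1/2 - 1/(2⌊n/2⌋-2).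
module Submission where

open import Defs
open import Data.Bool using (Bool; true; false; not; _∧_)
open import Data.Bool.Properties using () renaming (_≟_ to _≟ᵇ_)
open import Data.Fin as Fin using (Fin; _≟_)
open import Data.List using (List; []; _∷_; _++_; map; concatMap; allFin; filter; length; tabulate)
open import Data.Nat using (ℕ; zero; suc; z≤n; s≤s)
import Data.Nat.Properties as ℕ
open import Data.Nat.DivMod using (m/n*n≤m)
open import Data.Product using (_,_)
open import Data.Vec.Functional using (Vector)
open import Data.Vec.Properties using (updateAt-commutes)
open import Function using (_∘_; id; _⟨_⟩_)
open import Function.Bundles using (mk⇔)
open import Level using (Level)
open import Relation.Binary.PropositionalEquality
open import Relation.Nullary using (Dec; does; yes; no; ¬_)
open import Relation.Nullary.Decidable using (dec-true; dec-false; does-⇔)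
open import Relation.Unary using (Pred; Decidable)

module _ where
  open import Data.Integer using (ℤ; +_; -_; _+_; _-_; _*_; _≤_; 0ℤ; nonNegative; +≤+; +0; +[1+_]; -[1+_])
  import Data.Integer.Properties as ℤ
  open import Data.Integer.Tactic.RingSolver using (solve-∀)
  open import Data.Nat using (_∸_) renaming (_≤_ to _≤ℕ_; _*_ to _*ℕ_)
  open import Algebra.Properties.Semiring.Sum ℤ.+-*-semiring
    using (sum; sum-syntax; sum-cong-≗; ∑-distrib-+; ∑-comm; *-distribˡ-sum; *-distribʳ-sum; sum-replicate-zero)

  private variable
    n : ℕ
    ℓ : Level
    A B : Set

  -- Finite sums over ℤ

  ∑-neg : (f : Vector ℤ n) → ∑[ i < n ] (- f i) ≡ - sum f
  ∑-neg {zero} f = refl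
  ∑-neg {suc n} f = trans (cong (_+_ (- f Fin.zero)) (∑-neg (f ∘ Fin.suc)))
                          (sym (ℤ.neg-distrib-+ (f Fin.zero) (sum (f ∘ Fin.suc))))

  ∑-distrib-- : (f g : Vector ℤ n) → ∑[ i < n ] (f i - g i) ≡ sum f - sum g
  ∑-distrib-- f g = trans (∑-distrib-+ f (λ i → - g i)) (cong (_+_ (sum f)) (∑-neg g))

  ∑-distrib-+- : (f g h : Vector ℤ n) → ∑[ i < n ] (f i + g i - h i) ≡ sum f + sum g - sum h
  ∑-distrib-+- f g h = trans (∑-distrib-- (λ i → f i + g i) h) (cong (_- sum h) (∑-distrib-+ f g))

  ∑-const : ∀ n (c : ℤ) → ∑[ i < n ] c ≡ + n * c
  ∑-const zero c = refl
  ∑-const (suc n) c = trans (cong (_+_ c) (∑-const n c)) (sym (ℤ.suc-* (+ n) c))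

  ∑-mono-≤ : {f g : Vector ℤ n} → (∀ i → f i ≤ g i) → sum f ≤ sum g
  ∑-mono-≤ {zero} f≤g = ℤ.≤-refl
  ∑-mono-≤ {suc n} f≤g = ℤ.+-mono-≤ (f≤g Fin.zero) (∑-mono-≤ (λ i → f≤g (Fin.suc i)))

  ∑-nonNeg : {f : Vector ℤ n} → (∀ i → 0ℤ ≤ f i) → 0ℤ ≤ sum f
  ∑-nonNeg {n} {f} 0≤f = subst (_≤ sum f) (sum-replicate-zero n) (∑-mono-≤ {g = f} 0≤f)

  ∑-*-∑ : ∀ {m} (f : Vector ℤ m) (g : Vector ℤ n) → ∑[ i < m ] ∑[ j < n ] (f i * g j) ≡ sum f * sum g
  ∑-*-∑ f g = begin
    ∑[ i < _ ] ∑[ j < _ ] (f i * g j) ≡⟨ sum-cong-≗ (λ i → *-distribˡ-sum (f i) g) ⟨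
    ∑[ i < _ ] (f i * sum g)          ≡⟨ *-distribʳ-sum (sum g) f ⟨
    sum f * sum g                     ∎
    where open ≡-Reasoning

  ∑⁴-cong : {f f′ : Fin n → Fin n → Fin n → Fin n → ℤ} → (∀ i j k l → f i j k l ≡ f′ i j k l) →
    ∑[ i < n ] ∑[ j < n ] ∑[ k < n ] ∑[ l < n ] f i j k l ≡ ∑[ i < n ] ∑[ j < n ] ∑[ k < n ] ∑[ l < n ] f′ i j k l
  ∑⁴-cong f≡f′ = sum-cong-≗ λ i → sum-cong-≗ λ j → sum-cong-≗ λ k → sum-cong-≗ λ l → f≡f′ i j k l

  0≤i*j : ∀ {i j} → 0ℤ ≤ i → 0ℤ ≤ j → 0ℤ ≤ i * j
  0≤i*j {i} {j} 0≤i 0≤j = ℤ.*-monoʳ-≤-nonNeg j {{nonNegative 0≤j}} 0≤i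

  0≤i*i : ∀ i → 0ℤ ≤ i * i
  0≤i*i +0 = +≤+ z≤n
  0≤i*i +[1+ m ] = +≤+ z≤n
  0≤i*i -[1+ m ] = +≤+ z≤n

  ∑∑-squares : (x y : Vector ℤ n) →
    ∑[ i < n ] ∑[ j < n ] (+ 2 * (x i * x j) - + 2 * (y i * y j)) ≡ + 2 * (sum x * sum x) - + 2 * (sum y * sum y)
  ∑∑-squares {n} x y = begin
    ∑[ i < n ] ∑[ j < n ] (+ 2 * (x i * x j) - + 2 * (y i * y j))
      ≡⟨ sum-cong-≗ (λ i → ∑-distrib-- (λ j → + 2 * (x i * x j)) (λ j → + 2 * (y i * y j))) ⟩
    ∑[ i < n ] (∑[ j < n ] (+ 2 * (x i * x j)) - ∑[ j < n ] (+ 2 * (y i * y j)))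
      ≡⟨ ∑-distrib-- (λ i → ∑[ j < n ] (+ 2 * (x i * x j))) (λ i → ∑[ j < n ] (+ 2 * (y i * y j))) ⟩
    ∑[ i < n ] ∑[ j < n ] (+ 2 * (x i * x j)) - ∑[ i < n ] ∑[ j < n ] (+ 2 * (y i * y j))
      ≡⟨ cong₂ _-_ (scaled x) (scaled y) ⟩
    + 2 * (sum x * sum x) - + 2 * (sum y * sum y) ∎
    where
    open ≡-Reasoning
    scaled : (z : Vector ℤ n) → ∑[ i < n ] ∑[ j < n ] (+ 2 * (z i * z j)) ≡ + 2 * (sum z * sum z)
    scaled z = begin
      ∑[ i < n ] ∑[ j < n ] (+ 2 * (z i * z j))   ≡⟨ sum-cong-≗ (λ i → sym (*-distribˡ-sum (+ 2) (λ j → z i * z j))) ⟩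
      ∑[ i < n ] (+ 2 * ∑[ j < n ] (z i * z j))   ≡⟨ *-distribˡ-sum (+ 2) (λ i → ∑[ j < n ] (z i * z j)) ⟨
      + 2 * ∑[ i < n ] ∑[ j < n ] (z i * z j)     ≡⟨ cong (_*_ (+ 2)) (∑-*-∑ z z) ⟩
      + 2 * (sum z * sum z)                       ∎

  -- Lagrange's identity: the defect in Cauchy–Schwarz is a sum of squares.
  cauchy-schwarz : (u v : Vector ℤ n) →
    (∑[ k < n ] (u k * v k)) * (∑[ k < n ] (u k * v k)) ≤ (∑[ k < n ] (u k * u k)) * (∑[ k < n ] (v k * v k))
  cauchy-schwarz {n} u v = ℤ.0≤i-j⇒j≤i (ℤ.*-cancelˡ-≤-pos 0ℤ _ (+ 2) (subst (_≤_ 0ℤ) lagrange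
    (∑-nonNeg (λ k → ∑-nonNeg (λ l → 0≤i*i (u k * v l - u l * v k))))))
    where
    open ≡-Reasoning
    uu vv uv : Vector ℤ n
    uu k = u k * u k
    vv k = v k * v k
    uv k = u k * v k
    expand : ∀ uk ul vk vl → (uk * vl - ul * vk) * (uk * vl - ul * vk)
           ≡ (uk * uk) * (vl * vl) + (vk * vk) * (ul * ul) - (+ 2 * (uk * vk)) * (ul * vl)
    expand = solve-∀
    regroup : ∀ a b c → a * b + b * a - (+ 2 * c) * c ≡ + 2 * (a * b - c * c)
    regroup = solve-∀
    lagrange : ∑[ k < n ] ∑[ l < n ] ((u k * v l - u l * v k) * (u k * v l - u l * v k))
             ≡ + 2 * (sum uu * sum vv - sum uv * sum uv)
    lagrange = begin
      ∑[ k < n ] ∑[ l < n ] ((u k * v l - u l * v k) * (u k * v l - u l * v k))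
        ≡⟨ sum-cong-≗ (λ k → trans (sum-cong-≗ (λ l → expand (u k) (u l) (v k) (v l)))
                                   (∑-distrib-+- (λ l → uu k * vv l) (λ l → vv k * uu l) (λ l → (+ 2 * uv k) * uv l))) ⟩
      ∑[ k < n ] (∑[ l < n ] (uu k * vv l) + ∑[ l < n ] (vv k * uu l) - ∑[ l < n ] ((+ 2 * uv k) * uv l))
        ≡⟨ ∑-distrib-+- (λ k → ∑[ l < n ] (uu k * vv l)) (λ k → ∑[ l < n ] (vv k * uu l))
                        (λ k → ∑[ l < n ] ((+ 2 * uv k) * uv l)) ⟩
      ∑[ k < n ] ∑[ l < n ] (uu k * vv l) + ∑[ k < n ] ∑[ l < n ] (vv k * uu l) - ∑[ k < n ] ∑[ l < n ] ((+ 2 * uv k) * uv l)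
        ≡⟨ cong₂ _-_ (cong₂ _+_ (∑-*-∑ uu vv) (∑-*-∑ vv uu))
                     (trans (∑-*-∑ (λ k → + 2 * uv k) uv) (cong (_* sum uv) (sym (*-distribˡ-sum (+ 2) uv)))) ⟩
      sum uu * sum vv + sum vv * sum uu - (+ 2 * sum uv) * sum uv
        ≡⟨ regroup (sum uu) (sum vv) (sum uv) ⟩
      + 2 * (sum uu * sum vv - sum uv * sum uv) ∎

  -- Iverson brackets

  ⟦_⟧ : Bool → ℤ
  ⟦ true ⟧ = + 1
  ⟦ false ⟧ = 0ℤ

  ⟦⟧-∧ : ∀ a b → ⟦ a ∧ b ⟧ ≡ ⟦ a ⟧ * ⟦ b ⟧
  ⟦⟧-∧ true true = refl
  ⟦⟧-∧ true false = refl
  ⟦⟧-∧ false b = refl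

  ⟦⟧-not : ∀ a → ⟦ not a ⟧ ≡ + 1 - ⟦ a ⟧
  ⟦⟧-not true = refl
  ⟦⟧-not false = refl

  ⟦⟧-idem : ∀ a → ⟦ a ⟧ * ⟦ a ⟧ ≡ ⟦ a ⟧
  ⟦⟧-idem true = refl
  ⟦⟧-idem false = refl

  sign : Bool → ℤ
  sign true = + 1
  sign false = - + 1

  sign-sq : ∀ a → sign a * sign a ≡ + 1
  sign-sq true = refl
  sign-sq false = refl

  sign-agreement : ∀ a b → + 2 * ⟦ does (a ≟ᵇ b) ⟧ - + 1 ≡ sign a * sign b
  sign-agreement true true = refl
  sign-agreement true false = refl
  sign-agreement false true = refl
  sign-agreement false false = refl

  𝟙≡ 𝟙≢ : Fin n → Fin n → ℤ
  𝟙≡ i j = ⟦ does (i ≟ j) ⟧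
  𝟙≢ i j = ⟦ not (does (i ≟ j)) ⟧

  𝟙≢-idem : (i j : Fin n) → 𝟙≢ i j * 𝟙≢ i j ≡ 𝟙≢ i j
  𝟙≢-idem i j = ⟦⟧-idem (not (does (i ≟ j)))

  𝟙≢-refl : (i : Fin n) → 𝟙≢ i i ≡ 0ℤ
  𝟙≢-refl i = cong (⟦_⟧ ∘ not) (dec-true (i ≟ i) refl)

  𝟙≢-sym : (i j : Fin n) → 𝟙≢ i j ≡ 𝟙≢ j i
  𝟙≢-sym i j = cong (⟦_⟧ ∘ not) (does-⇔ (mk⇔ sym sym) (i ≟ j) (j ≟ i))

  𝟙≢-≢ : {i j : Fin n} → ¬ i ≡ j → 𝟙≢ i j ≡ + 1
  𝟙≢-≢ {i = i} {j} i≢j = cong (⟦_⟧ ∘ not) (dec-false (i ≟ j) i≢j)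

  ∑-𝟙≡ : (i : Fin n) (h : Vector ℤ n) → ∑[ k < n ] (𝟙≡ i k * h k) ≡ h i
  ∑-𝟙≡ {suc n} Fin.zero h = begin
    + 1 * h Fin.zero + ∑[ k < n ] (0ℤ * h (Fin.suc k)) ≡⟨ cong₂ _+_ (ℤ.*-identityˡ (h Fin.zero)) (sum-replicate-zero n) ⟩
    h Fin.zero + 0ℤ                                    ≡⟨ ℤ.+-identityʳ (h Fin.zero) ⟩
    h Fin.zero                                         ∎
    where open ≡-Reasoning
  ∑-𝟙≡ {suc n} (Fin.suc i) h = trans (ℤ.+-identityˡ _) (∑-𝟙≡ i (λ k → h (Fin.suc k)))

  ∑-𝟙≢ : (i : Fin n) (h : Vector ℤ n) → ∑[ k < n ] (𝟙≢ i k * h k) ≡ sum h - h i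
  ∑-𝟙≢ {n} i h = begin
    ∑[ k < n ] (𝟙≢ i k * h k)              ≡⟨ sum-cong-≗ (λ k → trans (cong (_* h k) (⟦⟧-not (does (i ≟ k))))
                                                                       (complement (𝟙≡ i k) (h k))) ⟩
    ∑[ k < n ] (h k - 𝟙≡ i k * h k)        ≡⟨ ∑-distrib-- h (λ k → 𝟙≡ i k * h k) ⟩
    sum h - ∑[ k < n ] (𝟙≡ i k * h k)      ≡⟨ cong (_-_ (sum h)) (∑-𝟙≡ i h) ⟩
    sum h - h i                            ∎
    where
    open ≡-Reasoning
    complement : ∀ d x → (+ 1 - d) * x ≡ x - d * x
    complement = solve-∀

  avoid : Fin n → Fin n → Fin n → ℤ
  avoid i j k = 𝟙≢ i k * 𝟙≢ j k

  ∑-avoiding : {i j : Fin n} → ¬ i ≡ j → (h : Vector ℤ n) →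
    ∑[ k < n ] (avoid i j k * h k) ≡ sum h - h i - h j
  ∑-avoiding {n} {i} {j} i≢j h = begin
    ∑[ k < n ] (𝟙≢ i k * 𝟙≢ j k * h k)       ≡⟨ sum-cong-≗ (λ k → ℤ.*-assoc (𝟙≢ i k) (𝟙≢ j k) (h k)) ⟩
    ∑[ k < n ] (𝟙≢ i k * (𝟙≢ j k * h k))     ≡⟨ ∑-𝟙≢ i (λ k → 𝟙≢ j k * h k) ⟩
    ∑[ k < n ] (𝟙≢ j k * h k) - 𝟙≢ j i * h i ≡⟨ cong₂ _-_ (∑-𝟙≢ j h)
                                                (trans (cong (_* h i) (𝟙≢-≢ (i≢j ∘ sym))) (ℤ.*-identityˡ (h i))) ⟩
    sum h - h j - h i                        ≡⟨ swap (sum h) (h j) (h i) ⟩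
    sum h - h i - h j                        ∎
    where
    open ≡-Reasoning
    swap : ∀ a b c → a - b - c ≡ a - c - b
    swap = solve-∀

  ∑-𝟙≢-const : (i : Fin n) → ∑[ k < n ] 𝟙≢ i k ≡ + n - + 1
  ∑-𝟙≢-const {n} i = begin
    ∑[ k < n ] 𝟙≢ i k                ≡⟨ sum-cong-≗ (λ k → ℤ.*-identityʳ (𝟙≢ i k)) ⟨
    ∑[ k < n ] (𝟙≢ i k * + 1)        ≡⟨ ∑-𝟙≢ i (λ _ → + 1) ⟩
    ∑[ k < n ] (+ 1) - + 1           ≡⟨ cong (_- + 1) (trans (∑-const n (+ 1)) (ℤ.*-identityʳ (+ n))) ⟩
    + n - + 1                        ∎
    where open ≡-Reasoning

  avoid-idem : (i j k : Fin n) → avoid i j k * avoid i j k ≡ avoid i j k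
  avoid-idem i j k = trans (interchange (𝟙≢ i k) (𝟙≢ j k)) (cong₂ _*_ (𝟙≢-idem i k) (𝟙≢-idem j k))
    where
    interchange : ∀ x y → (x * y) * (x * y) ≡ (x * x) * (y * y)
    interchange = solve-∀

  ∑-avoid² : {i j : Fin n} → ¬ i ≡ j → ∑[ k < n ] (avoid i j k * avoid i j k) ≡ + n - + 2
  ∑-avoid² {n} {i} {j} i≢j = begin
    ∑[ k < n ] (avoid i j k * avoid i j k) ≡⟨ sum-cong-≗ (λ k → trans (avoid-idem i j k)
                                                                     (sym (ℤ.*-identityʳ (avoid i j k)))) ⟩
    ∑[ k < n ] (avoid i j k * + 1)         ≡⟨ ∑-avoiding i≢j (λ _ → + 1) ⟩
    ∑[ k < n ] (+ 1) - + 1 - + 1           ≡⟨ cong (λ x → x - + 1 - + 1) (∑-const n (+ 1)) ⟩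
    + n * + 1 - + 1 - + 1                  ≡⟨ simplify (+ n) ⟩
    + n - + 2                              ∎
    where
    open ≡-Reasoning
    simplify : ∀ m → m * + 1 - + 1 - + 1 ≡ m - + 2
    simplify = solve-∀

  signed-difference-sq : ∀ a b c e → let x = ⟦ a ⟧; y = ⟦ b ⟧; p = sign c; q = sign e in
    (x * y * (x * p - y * q)) * (x * y * (x * p - y * q)) ≡ + 2 * (x * y) - + 2 * ((x * p) * (y * q))
  signed-difference-sq false b c e = refl
  signed-difference-sq true false true true = refl
  signed-difference-sq true false true false = refl
  signed-difference-sq true false false true = refl
  signed-difference-sq true false false false = refl
  signed-difference-sq true true true true = refl
  signed-difference-sq true true true false = refl
  signed-difference-sq true true false true = refl
  signed-difference-sq true true false false = refl

  -- The coefficient N - 1 is cancelled at the end; the remaining slack is (N - 3) s², hence N ≥ 3.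
  variance-bound⇒angle-bound : ∀ {m} → 3 ≤ℕ m → ∀ s y →
    + 2 * (+ m * y) - + 2 * (s * s) ≤ (+ m - + 2) * (+ 2 * (+ m * ((+ m - + 1) * (+ m - + 1))) - + 2 * y) →
    - (+ 2 * (+ m * ((+ m - + 1) * (+ m - + 3)))) ≤ s * s - + 4 * y + + 2 * (+ m * (+ m - + 1))
  variance-bound⇒angle-bound {m@(suc (suc (suc k)))} (s≤s (s≤s (s≤s _))) s y variance =
    ℤ.0≤i-j⇒j≤i (ℤ.*-cancelˡ-≤-pos 0ℤ _ (+ m - + 1)
      (subst₂ _≤_ (sym (ℤ.*-zeroʳ (+ m - + 1))) (sym (identity (+ m) s y))
        (ℤ.+-mono-≤ (ℤ.i≤j⇒0≤j-i variance) (0≤i*j {+ k} (+≤+ z≤n) (0≤i*i s)))))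
    where
    identity : ∀ N s y →
      (N - + 1) * (s * s - + 4 * y + + 2 * (N * (N - + 1)) - - (+ 2 * (N * ((N - + 1) * (N - + 3)))))
      ≡ (N - + 2) * (+ 2 * (N * ((N - + 1) * (N - + 1))) - + 2 * y) - (+ 2 * (N * y) - + 2 * (s * s)) + (N - + 3) * (s * s)
    identity = solve-∀

  -- χ is a 2-colouring of the complete graph on Fin n and g its ±1 matrix with zero diagonal. angleSum sums
  -- g i j * g k l over distinct i, j, k, l: equally minus differently coloured ordered pairs of disjoint edges.
  module SignedCompleteGraph {n : ℕ} (χ : Fin n → Fin n → Bool) (χ-sym : ∀ i j → χ i j ≡ χ j i) where

    open ≡-Reasoning

    g : Fin n → Fin n → ℤ
    g i j = 𝟙≢ i j * sign (χ i j)

    g-sym : ∀ i j → g i j ≡ g j i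
    g-sym i j = cong₂ _*_ (𝟙≢-sym i j) (cong sign (χ-sym i j))

    g-refl : ∀ i → g i i ≡ 0ℤ
    g-refl i = cong (_* sign (χ i i)) (𝟙≢-refl i)

    g-≡ : ∀ {i j} → i ≡ j → g i j ≡ 0ℤ
    g-≡ {i} refl = g-refl i

    g-sq : ∀ i j → g i j * g i j ≡ 𝟙≢ i j
    g-sq i j = begin
      g i j * g i j                                         ≡⟨ interchange (𝟙≢ i j) (sign (χ i j)) ⟩
      (𝟙≢ i j * 𝟙≢ i j) * (sign (χ i j) * sign (χ i j))     ≡⟨ cong₂ _*_ (𝟙≢-idem i j) (sign-sq (χ i j)) ⟩
      𝟙≢ i j * + 1                                          ≡⟨ ℤ.*-identityʳ (𝟙≢ i j) ⟩
      𝟙≢ i j                                                ∎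
      where
      interchange : ∀ x y → (x * y) * (x * y) ≡ (x * x) * (y * y)
      interchange = solve-∀

    deg : Fin n → ℤ
    deg i = ∑[ j < n ] g i j

    ∑deg ∑deg² : ℤ
    ∑deg = sum deg
    ∑deg² = ∑[ i < n ] (deg i * deg i)

    angleSum : ℤ
    angleSum = ∑[ i < n ] ∑[ j < n ] ∑[ k < n ] ∑[ l < n ] (g i j * g k l * avoid i j k * avoid i j l)

    deg-col : ∀ j → ∑[ i < n ] g i j ≡ deg j
    deg-col j = sum-cong-≗ (λ i → g-sym i j)

    ∑-g-sq : ∀ i → ∑[ j < n ] (g i j * g i j) ≡ + n - + 1
    ∑-g-sq i = trans (sum-cong-≗ (g-sq i)) (∑-𝟙≢-const i)

    ∑-g-deg : ∑[ i < n ] ∑[ j < n ] (g i j * deg j) ≡ ∑deg²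
    ∑-g-deg = begin
      ∑[ i < n ] ∑[ j < n ] (g i j * deg j)  ≡⟨ ∑-comm (λ i j → g i j * deg j) ⟩
      ∑[ j < n ] ∑[ i < n ] (g i j * deg j)  ≡⟨ sum-cong-≗ (λ j → trans (sym (*-distribʳ-sum (deg j) (λ i → g i j)))
                                                                        (cong (_* deg j) (deg-col j))) ⟩
      ∑deg²                                  ∎

    ∑-avoiding² : {i j : Fin n} → ¬ i ≡ j →
      ∑[ k < n ] ∑[ l < n ] (g k l * avoid i j k * avoid i j l) ≡ ∑deg - + 2 * deg i - + 2 * deg j + + 2 * g i j
    ∑-avoiding² {i} {j} i≢j = begin
      ∑[ k < n ] ∑[ l < n ] (g k l * avoid i j k * avoid i j l)
        ≡⟨ sum-cong-≗ (λ k → trans (sum-cong-≗ (λ l → reorder (g k l) (avoid i j k) (avoid i j l)))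
                                   (sym (*-distribˡ-sum (avoid i j k) (λ l → avoid i j l * g k l)))) ⟩
      ∑[ k < n ] (avoid i j k * ∑[ l < n ] (avoid i j l * g k l))
        ≡⟨ sum-cong-≗ (λ k → cong (_*_ (avoid i j k))
             (trans (∑-avoiding i≢j (g k)) (cong₂ (λ x y → deg k - x - y) (g-sym k i) (g-sym k j)))) ⟩
      ∑[ k < n ] (avoid i j k * h k)
        ≡⟨ ∑-avoiding i≢j h ⟩
      sum h - h i - h j
        ≡⟨ cong₂ (λ x y → x - y - h j) ∑h (cong₂ (λ x y → deg i - x - y) (g-refl i) (g-sym j i)) ⟩
      ∑deg - deg i - deg j - (deg i - 0ℤ - g i j) - (deg j - g i j - g j j)
        ≡⟨ cong (λ x → ∑deg - deg i - deg j - (deg i - 0ℤ - g i j) - (deg j - g i j - x)) (g-refl j) ⟩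
      ∑deg - deg i - deg j - (deg i - 0ℤ - g i j) - (deg j - g i j - 0ℤ)
        ≡⟨ collect ∑deg (deg i) (deg j) (g i j) ⟩
      ∑deg - + 2 * deg i - + 2 * deg j + + 2 * g i j ∎
      where
      h : Fin n → ℤ
      h k = deg k - g i k - g j k
      ∑h : sum h ≡ ∑deg - deg i - deg j
      ∑h = trans (∑-distrib-- (λ k → deg k - g i k) (g j)) (cong (_- deg j) (∑-distrib-- deg (g i)))
      reorder : ∀ x a b → x * a * b ≡ a * (b * x)
      reorder = solve-∀
      collect : ∀ s x y z → s - x - y - (x - 0ℤ - z) - (y - z - 0ℤ) ≡ s - + 2 * x - + 2 * y + + 2 * z
      collect = solve-∀

    angleSum-pair : ∀ i j → ∑[ k < n ] ∑[ l < n ] (g i j * g k l * avoid i j k * avoid i j l)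
                          ≡ g i j * (∑deg - + 2 * deg i - + 2 * deg j + + 2 * g i j)
    angleSum-pair i j = begin
      ∑[ k < n ] ∑[ l < n ] (g i j * g k l * avoid i j k * avoid i j l)
        ≡⟨ sum-cong-≗ (λ k → trans (sum-cong-≗ (λ l → reassoc (g i j) (g k l) (avoid i j k) (avoid i j l)))
                                   (sym (*-distribˡ-sum (g i j) (λ l → g k l * avoid i j k * avoid i j l)))) ⟩
      ∑[ k < n ] (g i j * ∑[ l < n ] (g k l * avoid i j k * avoid i j l))
        ≡⟨ *-distribˡ-sum (g i j) (λ k → ∑[ l < n ] (g k l * avoid i j k * avoid i j l)) ⟨
      g i j * ∑[ k < n ] ∑[ l < n ] (g k l * avoid i j k * avoid i j l)
        ≡⟨ on-diagonal-or-not (i ≟ j) ⟩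
      g i j * (∑deg - + 2 * deg i - + 2 * deg j + + 2 * g i j) ∎
      where
      reassoc : ∀ x y a b → x * y * a * b ≡ x * (y * a * b)
      reassoc = solve-∀
      inner value : ℤ
      inner = ∑[ k < n ] ∑[ l < n ] (g k l * avoid i j k * avoid i j l)
      value = ∑deg - + 2 * deg i - + 2 * deg j + + 2 * g i j
      on-diagonal-or-not : Dec (i ≡ j) → g i j * inner ≡ g i j * value
      on-diagonal-or-not (no i≢j) = cong (_*_ (g i j)) (∑-avoiding² i≢j)
      on-diagonal-or-not (yes i≡j) = trans (cong (_* inner) (g-≡ i≡j)) (cong (_* value) (sym (g-≡ i≡j)))

    angleSum-row : ∀ i → ∑[ j < n ] (g i j * (∑deg - + 2 * deg i - + 2 * deg j + + 2 * g i j))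
                 ≡ (∑deg - + 2 * deg i) * deg i + + 2 * (+ n - + 1) - + 2 * ∑[ j < n ] (g i j * deg j)
    angleSum-row i = begin
      ∑[ j < n ] (g i j * (∑deg - + 2 * deg i - + 2 * deg j + + 2 * g i j))
        ≡⟨ sum-cong-≗ (λ j → expand ∑deg (deg i) (deg j) (g i j)) ⟩
      ∑[ j < n ] (a * g i j + + 2 * (g i j * g i j) - + 2 * (g i j * deg j))
        ≡⟨ ∑-distrib-+- (λ j → a * g i j) (λ j → + 2 * (g i j * g i j)) (λ j → + 2 * (g i j * deg j)) ⟩
      ∑[ j < n ] (a * g i j) + ∑[ j < n ] (+ 2 * (g i j * g i j)) - ∑[ j < n ] (+ 2 * (g i j * deg j))
        ≡⟨ cong₂ _-_ (cong₂ _+_ (sym (*-distribˡ-sum a (g i)))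
                                (trans (sym (*-distribˡ-sum (+ 2) (λ j → g i j * g i j))) (cong (_*_ (+ 2)) (∑-g-sq i))))
                     (sym (*-distribˡ-sum (+ 2) (λ j → g i j * deg j))) ⟩
      a * deg i + + 2 * (+ n - + 1) - + 2 * ∑[ j < n ] (g i j * deg j) ∎
      where
      a : ℤ
      a = ∑deg - + 2 * deg i
      expand : ∀ s x y z → z * (s - + 2 * x - + 2 * y + + 2 * z) ≡ (s - + 2 * x) * z + + 2 * (z * z) - + 2 * (z * y)
      expand = solve-∀

    angleSum-formula : angleSum ≡ ∑deg * ∑deg - + 4 * ∑deg² + + 2 * (+ n * (+ n - + 1))
    angleSum-formula = begin
      angleSum
        ≡⟨ sum-cong-≗ (λ i → trans (sum-cong-≗ (angleSum-pair i)) (angleSum-row i)) ⟩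
      ∑[ i < n ] ((∑deg - + 2 * deg i) * deg i + + 2 * (+ n - + 1) - + 2 * ∑[ j < n ] (g i j * deg j))
        ≡⟨ ∑-distrib-+- (λ i → (∑deg - + 2 * deg i) * deg i) (λ _ → + 2 * (+ n - + 1))
                        (λ i → + 2 * ∑[ j < n ] (g i j * deg j)) ⟩
      ∑[ i < n ] ((∑deg - + 2 * deg i) * deg i) + ∑[ i < n ] (+ 2 * (+ n - + 1)) - ∑[ i < n ] (+ 2 * ∑[ j < n ] (g i j * deg j))
        ≡⟨ cong₂ _-_ (cong₂ _+_ ∑-first (∑-const n (+ 2 * (+ n - + 1))))
                     (trans (sym (*-distribˡ-sum (+ 2) (λ i → ∑[ j < n ] (g i j * deg j)))) (cong (_*_ (+ 2)) ∑-g-deg)) ⟩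
      (∑deg * ∑deg - + 2 * ∑deg²) + + n * (+ 2 * (+ n - + 1)) - + 2 * ∑deg²
        ≡⟨ collect (+ n) ∑deg ∑deg² ⟩
      ∑deg * ∑deg - + 4 * ∑deg² + + 2 * (+ n * (+ n - + 1)) ∎
      where
      ∑-first : ∑[ i < n ] ((∑deg - + 2 * deg i) * deg i) ≡ ∑deg * ∑deg - + 2 * ∑deg²
      ∑-first = begin
        ∑[ i < n ] ((∑deg - + 2 * deg i) * deg i)          ≡⟨ sum-cong-≗ (λ i → distrib ∑deg (deg i)) ⟩
        ∑[ i < n ] (∑deg * deg i - + 2 * (deg i * deg i))
          ≡⟨ ∑-distrib-- (λ i → ∑deg * deg i) (λ i → + 2 * (deg i * deg i)) ⟩
        ∑[ i < n ] (∑deg * deg i) - ∑[ i < n ] (+ 2 * (deg i * deg i))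
          ≡⟨ cong₂ _-_ (sym (*-distribˡ-sum ∑deg deg)) (sym (*-distribˡ-sum (+ 2) (λ i → deg i * deg i))) ⟩
        ∑deg * ∑deg - + 2 * ∑deg²                          ∎
        where
        distrib : ∀ s x → (s - + 2 * x) * x ≡ s * x - + 2 * (x * x)
        distrib = solve-∀
      collect : ∀ m s y → (s * s - + 2 * y) + m * (+ 2 * (m - + 1)) - + 2 * y ≡ s * s - + 4 * y + + 2 * (m * (m - + 1))
      collect = solve-∀

    Δ : Fin n → Fin n → Fin n → ℤ
    Δ i j k = avoid i j k * (g i k - g j k)

    Δ-sq : ∀ i j k → Δ i j k * Δ i j k ≡ + 2 * avoid i j k - + 2 * (g i k * g j k)
    Δ-sq i j k = signed-difference-sq (not (does (i ≟ k))) (not (does (j ≟ k))) (χ i k) (χ j k)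

    deg-difference : ∀ {i j} → ¬ i ≡ j → ∑[ k < n ] (avoid i j k * Δ i j k) ≡ deg i - deg j
    deg-difference {i} {j} i≢j = begin
      ∑[ k < n ] (avoid i j k * Δ i j k)
        ≡⟨ sum-cong-≗ (λ k → trans (sym (ℤ.*-assoc (avoid i j k) (avoid i j k) (g i k - g j k)))
                                   (cong (_* (g i k - g j k)) (avoid-idem i j k))) ⟩
      ∑[ k < n ] (avoid i j k * (g i k - g j k))
        ≡⟨ ∑-avoiding i≢j (λ k → g i k - g j k) ⟩
      ∑[ k < n ] (g i k - g j k) - (g i i - g j i) - (g i j - g j j)
        ≡⟨ cong₂ (λ x y → ∑[ k < n ] (g i k - g j k) - (x - y) - (g i j - g j j)) (g-refl i) (g-sym j i) ⟩
      ∑[ k < n ] (g i k - g j k) - (0ℤ - g i j) - (g i j - g j j)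
        ≡⟨ cong₂ (λ x y → x - (0ℤ - g i j) - (g i j - y)) (∑-distrib-- (g i) (g j)) (g-refl j) ⟩
      deg i - deg j - (0ℤ - g i j) - (g i j - 0ℤ)
        ≡⟨ cancel (deg i - deg j) (g i j) ⟩
      deg i - deg j ∎
      where
      cancel : ∀ d x → d - (0ℤ - x) - (x - 0ℤ) ≡ d
      cancel = solve-∀

    ∑Δ² : ∑[ i < n ] ∑[ j < n ] ∑[ k < n ] (Δ i j k * Δ i j k)
        ≡ + 2 * (+ n * ((+ n - + 1) * (+ n - + 1))) - + 2 * ∑deg²
    ∑Δ² = begin
      ∑[ i < n ] ∑[ j < n ] ∑[ k < n ] (Δ i j k * Δ i j k)
        ≡⟨ sum-cong-≗ (λ i → ∑-comm (λ j k → Δ i j k * Δ i j k)) ⟩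
      ∑[ i < n ] ∑[ k < n ] ∑[ j < n ] (Δ i j k * Δ i j k)
        ≡⟨ ∑-comm (λ i k → ∑[ j < n ] (Δ i j k * Δ i j k)) ⟩
      ∑[ k < n ] ∑[ i < n ] ∑[ j < n ] (Δ i j k * Δ i j k)
        ≡⟨ sum-cong-≗ (λ k → trans (sum-cong-≗ (λ i → sum-cong-≗ (λ j → Δ-sq i j k)))
                                   (∑∑-squares (λ i → 𝟙≢ i k) (λ i → g i k))) ⟩
      ∑[ k < n ] (+ 2 * (∑[ i < n ] 𝟙≢ i k * ∑[ i < n ] 𝟙≢ i k) - + 2 * (∑[ i < n ] g i k * ∑[ i < n ] g i k))
        ≡⟨ sum-cong-≗ (λ k → cong₂ (λ x y → + 2 * (x * x) - + 2 * (y * y)) (𝟙≢-col k) (deg-col k)) ⟩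
      ∑[ k < n ] (+ 2 * ((+ n - + 1) * (+ n - + 1)) - + 2 * (deg k * deg k))
        ≡⟨ ∑-distrib-- (λ _ → + 2 * ((+ n - + 1) * (+ n - + 1))) (λ k → + 2 * (deg k * deg k)) ⟩
      ∑[ k < n ] (+ 2 * ((+ n - + 1) * (+ n - + 1))) - ∑[ k < n ] (+ 2 * (deg k * deg k))
        ≡⟨ cong₂ _-_ (∑-const n _) (sym (*-distribˡ-sum (+ 2) (λ k → deg k * deg k))) ⟩
      + n * (+ 2 * ((+ n - + 1) * (+ n - + 1))) - + 2 * ∑deg²
        ≡⟨ regroup (+ n) ∑deg² ⟩
      + 2 * (+ n * ((+ n - + 1) * (+ n - + 1))) - + 2 * ∑deg² ∎
      where
      𝟙≢-col : ∀ k → ∑[ i < n ] 𝟙≢ i k ≡ + n - + 1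
      𝟙≢-col k = trans (sum-cong-≗ (λ i → 𝟙≢-sym i k)) (∑-𝟙≢-const k)
      regroup : ∀ m y → m * (+ 2 * ((m - + 1) * (m - + 1))) - + 2 * y ≡ + 2 * (m * ((m - + 1) * (m - + 1))) - + 2 * y
      regroup = solve-∀

    ∑-degree-gaps : ∑[ i < n ] ∑[ j < n ] ((deg i - deg j) * (deg i - deg j)) ≡ + 2 * (+ n * ∑deg²) - + 2 * (∑deg * ∑deg)
    ∑-degree-gaps = begin
      ∑[ i < n ] ∑[ j < n ] ((deg i - deg j) * (deg i - deg j))
        ≡⟨ sum-cong-≗ (λ i → trans (sum-cong-≗ (λ j → expand (deg i) (deg j)))
             (∑-distrib-+- (λ _ → deg i * deg i) (λ j → deg j * deg j) (λ j → (+ 2 * deg i) * deg j))) ⟩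
      ∑[ i < n ] (∑[ j < n ] (deg i * deg i) + ∑deg² - ∑[ j < n ] ((+ 2 * deg i) * deg j))
        ≡⟨ sum-cong-≗ (λ i → cong₂ (λ x y → x + ∑deg² - y) (∑-const n (deg i * deg i))
                                   (sym (*-distribˡ-sum (+ 2 * deg i) deg))) ⟩
      ∑[ i < n ] (+ n * (deg i * deg i) + ∑deg² - (+ 2 * deg i) * ∑deg)
        ≡⟨ ∑-distrib-+- (λ i → + n * (deg i * deg i)) (λ _ → ∑deg²) (λ i → (+ 2 * deg i) * ∑deg) ⟩
      ∑[ i < n ] (+ n * (deg i * deg i)) + ∑[ i < n ] ∑deg² - ∑[ i < n ] ((+ 2 * deg i) * ∑deg)
        ≡⟨ cong₂ _-_ (cong₂ _+_ (sym (*-distribˡ-sum (+ n) (λ i → deg i * deg i))) (∑-const n ∑deg²))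
                     (trans (sym (*-distribʳ-sum ∑deg (λ i → + 2 * deg i))) (cong (_* ∑deg) (sym (*-distribˡ-sum (+ 2) deg)))) ⟩
      + n * ∑deg² + + n * ∑deg² - (+ 2 * ∑deg) * ∑deg
        ≡⟨ collect (+ n) ∑deg² ∑deg ⟩
      + 2 * (+ n * ∑deg²) - + 2 * (∑deg * ∑deg) ∎
      where
      expand : ∀ x y → (x - y) * (x - y) ≡ x * x + y * y - (+ 2 * x) * y
      expand = solve-∀
      collect : ∀ m y s → m * y + m * y - (+ 2 * s) * s ≡ + 2 * (m * y) - + 2 * (s * s)
      collect = solve-∀

    degree-gap-bound : 2 ≤ℕ n → ∀ i j →
      (deg i - deg j) * (deg i - deg j) ≤ (+ n - + 2) * ∑[ k < n ] (Δ i j k * Δ i j k)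
    degree-gap-bound 2≤n i j = by-cases (i ≟ j)
      where
      bound : ℤ
      bound = (+ n - + 2) * ∑[ k < n ] (Δ i j k * Δ i j k)
      by-cases : Dec (i ≡ j) → (deg i - deg j) * (deg i - deg j) ≤ bound
      by-cases (yes i≡j) = subst (_≤ bound) (sym (cong (λ x → x * x) (ℤ.i≡j⇒i-j≡0 (cong deg i≡j))))
                             (0≤i*j (ℤ.i≤j⇒0≤j-i (+≤+ 2≤n)) (∑-nonNeg (λ k → 0≤i*i (Δ i j k))))
      by-cases (no i≢j) = subst₂ _≤_ (cong (λ x → x * x) (deg-difference i≢j))
                            (cong (_* ∑[ k < n ] (Δ i j k * Δ i j k)) (∑-avoid² i≢j))
                            (cauchy-schwarz (avoid i j) (Δ i j))

    degree-variance-bound : 2 ≤ℕ n →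
      + 2 * (+ n * ∑deg²) - + 2 * (∑deg * ∑deg) ≤ (+ n - + 2) * (+ 2 * (+ n * ((+ n - + 1) * (+ n - + 1))) - + 2 * ∑deg²)
    degree-variance-bound 2≤n = subst₂ _≤_ ∑-degree-gaps (trans factor (cong (_*_ (+ n - + 2)) ∑Δ²))
      (∑-mono-≤ (λ i → ∑-mono-≤ (degree-gap-bound 2≤n i)))
      where
      ‖Δ‖² : Fin n → Fin n → ℤ
      ‖Δ‖² i j = ∑[ k < n ] (Δ i j k * Δ i j k)
      factor : ∑[ i < n ] ∑[ j < n ] ((+ n - + 2) * ‖Δ‖² i j) ≡ (+ n - + 2) * ∑[ i < n ] ∑[ j < n ] ‖Δ‖² i j
      factor = trans (sum-cong-≗ (λ i → sym (*-distribˡ-sum (+ n - + 2) (‖Δ‖² i))))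
                     (sym (*-distribˡ-sum (+ n - + 2) (λ i → ∑[ j < n ] ‖Δ‖² i j)))

    angleSum-lower-bound : 3 ≤ℕ n → - (+ 2 * (+ n * ((+ n - + 1) * (+ n - + 3)))) ≤ angleSum
    angleSum-lower-bound 3≤n = subst (_ ≤_) (sym angleSum-formula)
      (variance-bound⇒angle-bound 3≤n ∑deg ∑deg² (degree-variance-bound (ℕ.≤-trans (ℕ.n≤1+n 2) 3≤n)))

  -- Sums over lists

  ∑ᴸ : (A → ℤ) → List A → ℤ
  ∑ᴸ w [] = 0ℤ
  ∑ᴸ w (x ∷ xs) = w x + ∑ᴸ w xs

  ∑ᴸ-++ : (w : A → ℤ) (xs ys : List A) → ∑ᴸ w (xs ++ ys) ≡ ∑ᴸ w xs + ∑ᴸ w ys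
  ∑ᴸ-++ w [] ys = sym (ℤ.+-identityˡ (∑ᴸ w ys))
  ∑ᴸ-++ w (x ∷ xs) ys = trans (cong (_+_ (w x)) (∑ᴸ-++ w xs ys)) (sym (ℤ.+-assoc (w x) (∑ᴸ w xs) (∑ᴸ w ys)))

  ∑ᴸ-concatMap : (w : B → ℤ) (f : A → List B) (xs : List A) → ∑ᴸ w (concatMap f xs) ≡ ∑ᴸ (∑ᴸ w ∘ f) xs
  ∑ᴸ-concatMap w f [] = refl
  ∑ᴸ-concatMap w f (x ∷ xs) = trans (∑ᴸ-++ w (f x) (concatMap f xs)) (cong (_+_ (∑ᴸ w (f x))) (∑ᴸ-concatMap w f xs))

  ∑ᴸ-map : (w : B → ℤ) (f : A → B) (xs : List A) → ∑ᴸ w (map f xs) ≡ ∑ᴸ (w ∘ f) xs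
  ∑ᴸ-map w f [] = refl
  ∑ᴸ-map w f (x ∷ xs) = cong (_+_ (w (f x))) (∑ᴸ-map w f xs)

  ∑ᴸ-tabulate : (w : A → ℤ) (f : Fin n → A) → ∑ᴸ w (tabulate f) ≡ ∑[ i < n ] w (f i)
  ∑ᴸ-tabulate {n = zero} w f = refl
  ∑ᴸ-tabulate {n = suc n} w f = cong (_+_ (w (f Fin.zero))) (∑ᴸ-tabulate w (f ∘ Fin.suc))

  length-filter-∑ᴸ : {P : Pred A ℓ} (P? : Decidable P) (xs : List A) →
    + length (filter P? xs) ≡ ∑ᴸ (λ x → ⟦ does (P? x) ⟧) xs
  length-filter-∑ᴸ P? [] = refl
  length-filter-∑ᴸ P? (x ∷ xs) with does (P? x)
  ... | true = trans (ℤ.pos-+ 1 (length (filter P? xs))) (cong (_+_ (+ 1)) (length-filter-∑ᴸ P? xs))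
  ... | false = trans (length-filter-∑ᴸ P? xs) (sym (ℤ.+-identityˡ _))

  ∑ᴸ-filter : {P : Pred A ℓ} (P? : Decidable P) (w : A → ℤ) (xs : List A) →
    ∑ᴸ w (filter P? xs) ≡ ∑ᴸ (λ x → ⟦ does (P? x) ⟧ * w x) xs
  ∑ᴸ-filter P? w [] = refl
  ∑ᴸ-filter P? w (x ∷ xs) with does (P? x)
  ... | true = cong₂ _+_ (sym (ℤ.*-identityˡ (w x))) (∑ᴸ-filter P? w xs)
  ... | false = trans (∑ᴸ-filter P? w xs) (sym (ℤ.+-identityˡ _))

  ∑ᴸ-distrib-- : (f g : A → ℤ) (xs : List A) → ∑ᴸ (λ x → f x - g x) xs ≡ ∑ᴸ f xs - ∑ᴸ g xs
  ∑ᴸ-distrib-- f g [] = refl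
  ∑ᴸ-distrib-- f g (x ∷ xs) = trans (cong (_+_ (f x - g x)) (∑ᴸ-distrib-- f g xs))
                                    (regroup (f x) (g x) (∑ᴸ f xs) (∑ᴸ g xs))
    where
    regroup : ∀ a b c d → a - b + (c - d) ≡ a + c - (b + d)
    regroup = solve-∀

  ∑ᴸ-mono-≤ : {w w′ : A → ℤ} → (∀ x → w x ≤ w′ x) → (xs : List A) → ∑ᴸ w xs ≤ ∑ᴸ w′ xs
  ∑ᴸ-mono-≤ w≤w′ [] = ℤ.≤-refl
  ∑ᴸ-mono-≤ w≤w′ (x ∷ xs) = ℤ.+-mono-≤ (w≤w′ x) (∑ᴸ-mono-≤ w≤w′ xs)

  *-distribˡ-∑ᴸ : (c : ℤ) (w : A → ℤ) (xs : List A) → c * ∑ᴸ w xs ≡ ∑ᴸ (λ x → c * w x) xs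
  *-distribˡ-∑ᴸ c w [] = ℤ.*-zeroʳ c
  *-distribˡ-∑ᴸ c w (x ∷ xs) = trans (ℤ.*-distribˡ-+ c (w x) (∑ᴸ w xs)) (cong (_+_ (c * w x)) (*-distribˡ-∑ᴸ c w xs))

  ∑ᴸ-concatMap-allFin : (w : B → ℤ) (f : Fin n → List B) → ∑ᴸ w (concatMap f (allFin n)) ≡ ∑[ i < n ] ∑ᴸ w (f i)
  ∑ᴸ-concatMap-allFin {n = n} w f = trans (∑ᴸ-concatMap w f (allFin n)) (∑ᴸ-tabulate (∑ᴸ w ∘ f) id)

  ∑ᴸ-map-allFin : (w : B → ℤ) (f : Fin n → B) → ∑ᴸ w (map f (allFin n)) ≡ ∑[ i < n ] w (f i)
  ∑ᴸ-map-allFin {n = n} w f = trans (∑ᴸ-map w f (allFin n)) (∑ᴸ-tabulate (w ∘ f) id)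

  -- Right angles of the cube

  ⊕-comm : (v : Cube n) (i j : Fin n) → (v ⊕ i) ⊕ j ≡ (v ⊕ j) ⊕ i
  ⊕-comm v i j with i ≟ j
  ... | yes refl = refl
  ... | no i≢j = updateAt-commutes j i (i≢j ∘ sym) v

  -- allConfigs n is definitionally concatMap configsAt (allCube n).
  configsAt : Cube n → List (Config n)
  configsAt {n} v = concatMap (λ i → concatMap (λ j → concatMap (λ k →
    map (λ l → (v , i , j , k , l)) (allFin n)) (allFin n)) (allFin n)) (allFin n)

  ∑ᴸ-configsAt : (w : Config n → ℤ) (v : Cube n) →
    ∑ᴸ w (configsAt v) ≡ ∑[ i < n ] ∑[ j < n ] ∑[ k < n ] ∑[ l < n ] w (v , i , j , k , l)
  ∑ᴸ-configsAt {n} w v =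
    trans (∑ᴸ-concatMap-allFin w withPrefix₁) (sum-cong-≗ λ i →
    trans (∑ᴸ-concatMap-allFin w (withPrefix₂ i)) (sum-cong-≗ λ j →
    trans (∑ᴸ-concatMap-allFin w (withPrefix₃ i j)) (sum-cong-≗ λ k →
    ∑ᴸ-map-allFin w (λ l → (v , i , j , k , l)))))
    where
    withPrefix₃ : Fin n → Fin n → Fin n → List (Config n)
    withPrefix₃ i j k = map (λ l → (v , i , j , k , l)) (allFin n)
    withPrefix₂ : Fin n → Fin n → List (Config n)
    withPrefix₂ i j = concatMap (withPrefix₃ i j) (allFin n)
    withPrefix₁ : Fin n → List (Config n)
    withPrefix₁ i = concatMap (withPrefix₂ i) (allFin n)

  distinct-signs : (v : Cube n) (i j k l : Fin n) (p q : ℤ) →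
    ⟦ does (distinct4? (v , i , j , k , l)) ⟧ * (p * q) ≡ 𝟙≢ i j * p * (𝟙≢ k l * q) * avoid i j k * avoid i j l
  distinct-signs v i j k l p q = begin
    ⟦ ij ∧ (ik ∧ (il ∧ (jk ∧ (jl ∧ kl)))) ⟧ * (p * q)
      ≡⟨ cong (_* (p * q)) (trans (⟦⟧-∧ ij _) (cong (_*_ ⟦ ij ⟧) (trans (⟦⟧-∧ ik _) (cong (_*_ ⟦ ik ⟧)
           (trans (⟦⟧-∧ il _) (cong (_*_ ⟦ il ⟧) (trans (⟦⟧-∧ jk _) (cong (_*_ ⟦ jk ⟧) (⟦⟧-∧ jl kl))))))))) ⟩
    ⟦ ij ⟧ * (⟦ ik ⟧ * (⟦ il ⟧ * (⟦ jk ⟧ * (⟦ jl ⟧ * ⟦ kl ⟧)))) * (p * q)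
      ≡⟨ regroup ⟦ ij ⟧ ⟦ ik ⟧ ⟦ il ⟧ ⟦ jk ⟧ ⟦ jl ⟧ ⟦ kl ⟧ p q ⟩
    𝟙≢ i j * p * (𝟙≢ k l * q) * avoid i j k * avoid i j l ∎
    where
    open ≡-Reasoning
    ij ik il jk jl kl : Bool
    ij = not (does (i ≟ j))
    ik = not (does (i ≟ k))
    il = not (does (i ≟ l))
    jk = not (does (j ≟ k))
    jl = not (does (j ≟ l))
    kl = not (does (k ≟ l))
    regroup : ∀ a b c d e f p q → a * (b * (c * (d * (e * f)))) * (p * q) ≡ a * p * (f * q) * (b * d) * (c * e)
    regroup = solve-∀

  link : Coloring n → Cube n → Fin n → Fin n → Bool
  link c v i j = colour c v ((v ⊕ i) ⊕ j)

  link-sym : (c : Coloring n) (v : Cube n) → ∀ i j → link c v i j ≡ link c v j i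
  link-sym c v i j = cong (colour c v) (⊕-comm v i j)

  rightAnglesAt : Cube n → ℤ
  rightAnglesAt v = ∑ᴸ (λ x → ⟦ does (distinct4? x) ⟧) (configsAt v)

  monoAnglesAt : Coloring n → Cube n → ℤ
  monoAnglesAt c v = ∑ᴸ (λ x → ⟦ does (distinct4? x) ⟧ * ⟦ does (mono? c x) ⟧) (configsAt v)

  length-rightAngles : (n : ℕ) → + length (rightAngles n) ≡ ∑ᴸ rightAnglesAt (allCube n)
  length-rightAngles n = trans (length-filter-∑ᴸ distinct4? (allConfigs n)) (∑ᴸ-concatMap _ configsAt (allCube n))

  length-monoAngles : (c : Coloring n) → + length (monoAngles c) ≡ ∑ᴸ (monoAnglesAt c) (allCube n)
  length-monoAngles {n} c = trans (length-filter-∑ᴸ (mono? c) (rightAngles n))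
    (trans (∑ᴸ-filter distinct4? _ (allConfigs n)) (∑ᴸ-concatMap _ configsAt (allCube n)))

  module ConstantColouring {n} = SignedCompleteGraph {n} (λ _ _ → true) (λ _ _ → refl)

  rightAnglesAt-angleSum : (v : Cube n) → rightAnglesAt v ≡ ConstantColouring.angleSum {n}
  rightAnglesAt-angleSum v = trans (∑ᴸ-configsAt _ v) (∑⁴-cong λ i j k l →
    trans (sym (ℤ.*-identityʳ _)) (distinct-signs v i j k l (+ 1) (+ 1)))

  monoAnglesAt-angleSum : (c : Coloring n) (v : Cube n) →
    + 2 * monoAnglesAt c v - rightAnglesAt v ≡ SignedCompleteGraph.angleSum (link c v) (link-sym c v)
  monoAnglesAt-angleSum c v = begin
    + 2 * monoAnglesAt c v - rightAnglesAt v
      ≡⟨ cong (_- rightAnglesAt v) (*-distribˡ-∑ᴸ (+ 2) _ (configsAt v)) ⟩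
    _ ≡⟨ ∑ᴸ-distrib-- _ _ (configsAt v) ⟨
    _ ≡⟨ ∑ᴸ-configsAt _ v ⟩
    _ ≡⟨ ∑⁴-cong (λ i j k l → pointwise (⟦ does (distinct4? (v , i , j , k , l)) ⟧) (link c v i j) (link c v k l)
                                ⟨ trans ⟩ distinct-signs v i j k l (sign (link c v i j)) (sign (link c v k l))) ⟩
    SignedCompleteGraph.angleSum (link c v) (link-sym c v) ∎
    where
    open ≡-Reasoning
    pointwise : ∀ d a b → + 2 * (d * ⟦ does (a ≟ᵇ b) ⟧) - d ≡ d * (sign a * sign b)
    pointwise d a b = trans (factor d ⟦ does (a ≟ᵇ b) ⟧) (cong (_*_ d) (sign-agreement a b))
      where
      factor : ∀ d m → + 2 * (d * m) - d ≡ d * (+ 2 * m - + 1)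
      factor = solve-∀

  angleSum-complete : ConstantColouring.angleSum {n} ≡ + n * ((+ n - + 1) * ((+ n - + 2) * (+ n - + 3)))
  angleSum-complete {n} = begin
    angleSum
      ≡⟨ angleSum-formula ⟩
    ∑deg * ∑deg - + 4 * ∑deg² + + 2 * (+ n * (+ n - + 1))
      ≡⟨ cong₂ (λ s y → s * s - + 4 * y + + 2 * (+ n * (+ n - + 1))) ∑deg≡ ∑deg²≡ ⟩
    (+ n * (+ n - + 1)) * (+ n * (+ n - + 1)) - + 4 * (+ n * ((+ n - + 1) * (+ n - + 1))) + + 2 * (+ n * (+ n - + 1))
      ≡⟨ factorise (+ n) ⟩
    + n * ((+ n - + 1) * ((+ n - + 2) * (+ n - + 3))) ∎
    where
    open ≡-Reasoning
    open ConstantColouring {n}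
    deg≡ : ∀ i → deg i ≡ + n - + 1
    deg≡ i = trans (sum-cong-≗ (λ j → ℤ.*-identityʳ (𝟙≢ i j))) (∑-𝟙≢-const i)
    ∑deg≡ : ∑deg ≡ + n * (+ n - + 1)
    ∑deg≡ = trans (sum-cong-≗ deg≡) (∑-const n _)
    ∑deg²≡ : ∑deg² ≡ + n * ((+ n - + 1) * (+ n - + 1))
    ∑deg²≡ = trans (sum-cong-≗ (λ i → cong₂ _*_ (deg≡ i) (deg≡ i))) (∑-const n _)
    factorise : ∀ m → (m * (m - + 1)) * (m * (m - + 1)) - + 4 * (m * ((m - + 1) * (m - + 1))) + + 2 * (m * (m - + 1))
                    ≡ m * ((m - + 1) * ((m - + 2) * (m - + 3)))
    factorise = solve-∀

  -- (N - 2)(2M - T) ≥ -2T for T = N(N-1)(N-2)(N-3), i.e. 2M/T ≥ 1 - 2/(N-2).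
  vertex-bound : 3 ≤ℕ n → (c : Coloring n) (v : Cube n) →
    (+ n - + 4) * rightAnglesAt v ≤ (+ 2 * (+ n - + 2)) * monoAnglesAt c v
  vertex-bound {n} 3≤n c v = subst (λ t → (+ n - + 4) * t ≤ (+ 2 * (+ n - + 2)) * M) (sym T≡)
    (ℤ.0≤i-j⇒j≤i (subst (_≤_ 0ℤ) (sym (identity (+ n) M))
      (0≤i*j (ℤ.i≤j⇒0≤j-i (+≤+ (ℕ.≤-trans (ℕ.n≤1+n 2) 3≤n))) (ℤ.i≤j⇒0≤j-i signed-bound))))
    where
    M T : ℤ
    M = monoAnglesAt c v
    T = + n * ((+ n - + 1) * ((+ n - + 2) * (+ n - + 3)))
    T≡ : rightAnglesAt v ≡ T
    T≡ = trans (rightAnglesAt-angleSum v) (angleSum-complete {n})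
    signed-bound : - (+ 2 * (+ n * ((+ n - + 1) * (+ n - + 3)))) ≤ + 2 * M - T
    signed-bound = subst (_ ≤_) (trans (sym (monoAnglesAt-angleSum c v)) (cong (λ t → + 2 * M - t) T≡))
      (SignedCompleteGraph.angleSum-lower-bound (link c v) (link-sym c v) 3≤n)
    identity : ∀ N M → let T = N * ((N - + 1) * ((N - + 2) * (N - + 3))) in
      (+ 2 * (N - + 2)) * M - (N - + 4) * T ≡ (N - + 2) * ((+ 2 * M - T) - - (+ 2 * (N * ((N - + 1) * (N - + 3)))))
    identity = solve-∀

  cube-bound : 3 ≤ℕ n → (c : Coloring n) →
    (+ n - + 4) * + length (rightAngles n) ≤ (+ 2 * (+ n - + 2)) * + length (monoAngles c)
  cube-bound {n} 3≤n c = subst₂ _≤_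
    (trans (sym (*-distribˡ-∑ᴸ (+ n - + 4) rightAnglesAt (allCube n)))
           (cong (_*_ (+ n - + 4)) (sym (length-rightAngles n))))
    (trans (sym (*-distribˡ-∑ᴸ (+ 2 * (+ n - + 2)) (monoAnglesAt c) (allCube n)))
           (cong (_*_ (+ 2 * (+ n - + 2))) (sym (length-monoAngles c))))
    (∑ᴸ-mono-≤ (vertex-bound 3≤n c) (allCube n))

  cube-bound-ℕ : 4 ≤ℕ n → (c : Coloring n) →
    (n ∸ 4) *ℕ length (rightAngles n) ≤ℕ 2 *ℕ (n ∸ 2) *ℕ length (monoAngles c)
  cube-bound-ℕ {n} 4≤n c = ℤ.drop‿+≤+ (subst₂ _≤_
    (trans (cong (_* + T) (+n-+m≡+[n∸m] 4≤n)) (sym (ℤ.pos-* (n ∸ 4) T)))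
    (trans (cong (λ x → + 2 * x * + M) (+n-+m≡+[n∸m] 2≤n))
           (trans (cong (_* + M) (sym (ℤ.pos-* 2 (n ∸ 2)))) (sym (ℤ.pos-* (2 *ℕ (n ∸ 2)) M))))
    (cube-bound 3≤n c))
    where
    T M : ℕ
    T = length (rightAngles n)
    M = length (monoAngles c)
    3≤n : 3 ≤ℕ n
    3≤n = ℕ.≤-trans (ℕ.n≤1+n 3) 4≤n
    2≤n : 2 ≤ℕ n
    2≤n = ℕ.≤-trans (ℕ.n≤1+n 2) 3≤n
    +n-+m≡+[n∸m] : ∀ {m n} → m ≤ℕ n → + n - + m ≡ + (n ∸ m)
    +n-+m≡+[n∸m] {m} {n} m≤n = trans (ℤ.m-n≡m⊖n n m) (ℤ.⊖-≥ m≤n)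

open import Data.Nat using (_+_; _*_; _∸_; _≤_; _/_)
open import Data.Nat.Properties
open import Data.Nat.Tactic.RingSolver using (solve-∀)

-- x ↦ (x - 4)/(x - 2) is increasing, and 2m ≤ n.
ratio-bound-mono : ∀ {n m t k} → 4 ≤ n → 2 * m ≤ n → (n ∸ 4) * t ≤ 2 * (n ∸ 2) * k → t * (m ∸ 2) ≤ 2 * (m ∸ 1) * k
ratio-bound-mono {m = 0} {t} _ _ _ = ≤-trans (≤-reflexive (*-zeroʳ t)) z≤n
ratio-bound-mono {m = 1} {t} _ _ _ = ≤-trans (≤-reflexive (*-zeroʳ t)) z≤n
ratio-bound-mono {_} {suc (suc m)} {t} {k} (s≤s (s≤s (s≤s (s≤s {n = n} _)))) 2m+4≤n+4 bound =
  *-cancelˡ-≤ (2 + n) (begin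
    (2 + n) * (t * m)           ≡⟨ rearrange n t m ⟩
    t * ((2 + n) * m)           ≤⟨ *-monoʳ-≤ t coefficients ⟩
    t * ((1 + m) * n)           ≡⟨ rearrange′ t m n ⟩
    (1 + m) * (n * t)           ≤⟨ *-monoʳ-≤ (1 + m) bound ⟩
    (1 + m) * (2 * (2 + n) * k) ≡⟨ rearrange″ m n k ⟩
    (2 + n) * (2 * (1 + m) * k) ∎)
  where
  open ≤-Reasoning
  2m≤n : 2 * m ≤ n
  2m≤n = +-cancelˡ-≤ 4 (2 * m) n (subst (_≤ 4 + n) (double-suc² m) 2m+4≤n+4)
    where
    double-suc² : ∀ m → 2 * (2 + m) ≡ 4 + 2 * m
    double-suc² = solve-∀
  coefficients : (2 + n) * m ≤ (1 + m) * n
  coefficients = begin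
    (2 + n) * m  ≡⟨ distrib n m ⟩
    2 * m + m * n ≤⟨ +-monoˡ-≤ (m * n) 2m≤n ⟩
    n + m * n    ∎
    where
    distrib : ∀ n m → (2 + n) * m ≡ 2 * m + m * n
    distrib = solve-∀
  rearrange : ∀ n t m → (2 + n) * (t * m) ≡ t * ((2 + n) * m)
  rearrange = solve-∀
  rearrange′ : ∀ t m n → t * ((1 + m) * n) ≡ (1 + m) * (n * t)
  rearrange′ = solve-∀
  rearrange″ : ∀ m n k → (1 + m) * (2 * (2 + n) * k) ≡ (2 + n) * (2 * (1 + m) * k)
  rearrange″ = solve-∀

lemma3p1 : (n : ℕ) → 4 ≤ n → (c : Coloring n) →
    length (rightAngles n) * ((n / 2) ∸ 2) ≤ 2 * ((n / 2) ∸ 1) * length (monoAngles c)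
lemma3p1 n 4≤n c = ratio-bound-mono {m = n / 2} 4≤n 2[n/2]≤n (cube-bound-ℕ 4≤n c)
  where
  2[n/2]≤n : 2 * (n / 2) ≤ n
  2[n/2]≤n = ≤-trans (≤-reflexive (*-comm 2 (n / 2))) (m/n*n≤m n 2)
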